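{- Let $G$ be an antimatroid on a finite ground set $S$ with $|S|=n$, and for $i,j\ge0$ let $a_{i,j}$ be the number of convex sets $C$ of $G$ with $|C|=i$ and $|\mathrm{int}(C)|=j$. Then: (1) for every integer $0\le k<n$, $$\sum_{i=0}^k\sum_{j=0}^{k-i}(-1)^j\binom{k-i}{j}\sum_{s=i}^n(-1)^{s-i}\binom{s}{i}a_{s,j}=0;$$ (2) for $k=n$, $$\sum_{i=0}^n\sum_{j=0}^{n-i}(-1)^j\binom{n-i}{j}\sum_{s=i}^n(-1)^{s-i}\binom{s}{i}a_{s,j}=1.$$
   Context: An antimatroid on a finite set $S$ is a family $\mathcal{F}$ of subsets of $S$ (the feasible sets) such that $\emptyset\in\mathcal{F}$, $S\in\mathcal{F}$, $\mathcal{F}$ is closed under unions, and every nonempty $F\in\mathcal{F}$ contains some $x$ with $F-x\in\mathcal{F}$. A set $C\subseteq S$ is convex if $S-C\in\mathcal{F}$. The convex closure $\overline{A}$ of $A\subseteq S$ is the smallest convex set containing $A$. For convex $C$, a point $p\in C$ is extreme if $p\notin\overline{C-p}$, and $\mathrm{int}(C)$ is the set of non-extreme points of $C$. -}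

module Defs where

open import Data.Bool using (Bool; true; false; _∧_; if_then_else_)
open import Data.Nat using (ℕ; zero; suc; _+_; _∸_; _≡ᵇ_)
open import Data.Nat.Combinatorics using (_C_)
open import Data.Integer using (ℤ; +_; -_) renaming (_+_ to _+ℤ_; _*_ to _*ℤ_)
open import Data.List using (List; []; _∷_; map; filterᵇ; length; upTo; foldr; _++_)
open import Data.Fin using (Fin)
open import Data.Fin.Subset using (Subset; inside; outside; ⊥; ⊤; _∈_; _∪_; _∩_; _-_; _⊆_; ∁; ∣_∣; Nonempty)
open import Data.Fin.Subset.Properties using (_∈?_; _⊆?_)
open import Data.Vec using (Vec; []; _∷_; tabulate)
open import Data.Product using (∃; _×_)
open import Relation.Binary.PropositionalEquality using (_≡_)
open import Relation.Nullary.Decidable using (⌊_⌋)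

-- A family of subsets of the ground set S = Fin n, given by its
-- (Boolean) membership predicate: F A ≡ true iff A is feasible.
Family : ℕ → Set
Family n = Subset n → Bool

record IsAntimatroid {n : ℕ} (F : Family n) : Set where
  field
    empty-feasible  : F ⊥ ≡ true
    full-feasible   : F ⊤ ≡ true
    union-closed    : ∀ A B → F A ≡ true → F B ≡ true → F (A ∪ B) ≡ true
    accessible      : ∀ A → F A ≡ true → Nonempty A →
                      ∃ λ x → x ∈ A × F (A - x) ≡ true

allSubsets : (n : ℕ) → List (Subset n)
allSubsets zero    = [] ∷ []
allSubsets (suc n) = map (outside ∷_) (allSubsets n) ++ map (inside ∷_) (allSubsets n)

convex : ∀ {n} → Family n → Subset n → Bool
convex F C = F (∁ C)

closure : ∀ {n} → Family n → Subset n → Subset n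
closure {n} F A =
  foldr _∩_ ⊤ (filterᵇ (λ D → ⌊ A ⊆? D ⌋ ∧ convex F D) (allSubsets n))

-- p ∈ C is extreme iff p ∉ closure (C − p); int C = non-extreme points of C
interior : ∀ {n} → Family n → Subset n → Subset n
interior F C = tabulate (λ p → if ⌊ p ∈? C ⌋ ∧ ⌊ p ∈? closure F (C - p) ⌋ then inside else outside)

a : ∀ {n} → Family n → ℕ → ℕ → ℕ
a {n} F i j =
  length (filterᵇ (λ C → convex F C ∧ (∣ C ∣ ≡ᵇ i) ∧ (∣ interior F C ∣ ≡ᵇ j)) (allSubsets n))

-- ∑[ lo , hi ] f = f lo + f (lo+1) + ... + f hi   (empty if hi < lo)
∑ : ℕ → ℕ → (ℕ → ℤ) → ℤ
∑ lo hi f = foldr _+ℤ_ (+ 0) (map (λ t → f (lo + t)) (upTo (suc hi ∸ lo)))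

sgn : ℕ → ℤ
sgn zero    = + 1
sgn (suc j) = - sgn j

E : ∀ {n} → Family n → ℕ → ℤ
E {n} F k =
  ∑ 0 k (λ i → ∑ 0 (k ∸ i) (λ j →
    (sgn j *ℤ + ((k ∸ i) C j)) *ℤ
    ∑ i n (λ s → sgn (s ∸ i) *ℤ (+ (s C i) *ℤ + a F s j))))

-- Grouping convex sets K by size and interior size writes E F k as ∑_K ψ k ∣K∣ ∣int K∣, where
-- ψ k s j = ∑_{i ≤ k} (-1)^(s-i) C(s,i) (-1)^j C(k-i,j).  By the Krein–Milman property of
-- antimatroids, closure A = K exactly when ext K ⊆ A ⊆ K; summing ψ k ∣A∣ 0 over this interval is
-- a binomial transform that Pascal's rule evaluates to ψ k ∣K∣ ∣int K∣.  Hence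
-- E F k = ∑_{A ⊆ S} ψ k ∣A∣ 0, which depends only on n: it is 1 for n ≤ k and 0 for k < n.

module Submission where

open import Data.Bool using (Bool; true; false; _∧_; if_then_else_)
import Data.Bool as Bool
open import Data.Bool.Properties using (∧-zeroʳ; T-∧; T-≡)
open import Data.Fin using (Fin; zero; suc)
import Data.Fin as Fin
open import Data.Fin.Properties using (any?)
open import Data.Fin.Subset using (Subset; inside; outside; ⊥; ⁅_⁆; ∁; _∈_; _∉_; _∪_; _─_; ⋂; ∣_∣; _⊆_)
open import Data.Fin.Subset.Properties
  using ( _⊆?_; _∈?_; drop-∷-⊆; ⊆-trans; ⊆-antisym; ∈⊤; ∣p∣≤n; ∣⊥∣≡0; p⊆q⇒∣p∣≤∣q∣
        ; p∩q⊆p; p∩q⊆q; x∈p∩q⁺; p⊆p∪q; x∈p∪q⁺; x∈p∪q⁻; ∪-identityʳ; x∈⁅x⁆; x∈⁅y⁆⇒x≡y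
        ; p─⊥≡p; p─q⊆p; x∈p∧x∉q⇒x∈p─q; x∈p∧x≢y⇒x∈p-y; x∈p⇒∣p-x∣<∣p∣
        ; x∉p⇒x∈∁p; x∈p⇒x∉∁p; x∈∁p⇒x∉p; x∉∁p⇒x∈p; ∪-∩-booleanAlgebra )
open import Data.Empty using (⊥-elim)
open import Data.Integer using (ℤ; +_; -_; _+_; _*_; _-_)
open import Data.Integer.Tactic.RingSolver using (solve-∀)
open import Data.List using (List; []; _∷_; map; foldr; filterᵇ; length; upTo; _++_)
open import Data.List.Properties using (map-applyUpTo; map-∘)
open import Data.List.Membership.Propositional using () renaming (_∈_ to _∈ᴸ_)
open import Data.List.Membership.Propositional.Properties
  using (∈-map⁺; ∈-++⁺ˡ; ∈-++⁺ʳ; ∈-filter⁺; ∈-filter⁻)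
open import Data.List.Relation.Unary.Any using (here; there)
open import Data.Nat as ℕ using (ℕ; zero; suc; _∸_; _≤_; _<_; _≡ᵇ_; z≤n; s≤s) renaming (_+_ to _+ℕ_)
import Data.Nat.Properties as ℕ
open import Data.Nat.Induction using (<-wellFounded)
open import Data.Nat.Combinatorics using (_C_; k>n⇒nCk≡0; nCk+nC[k+1]≡[n+1]C[k+1])
open import Data.Vec using (_∷_; []; tabulate)
import Data.Vec as Vec
open import Data.Vec.Properties using (≡-dec; lookup∘tabulate; []=⇒lookup; lookup⇒[]=)
open import Data.Product using (∃; _×_; _,_; proj₁; proj₂)
open import Data.Sum using (_⊎_; inj₁; inj₂)
import Data.Sum as Sum
open import Function using (_∘_; _⇔_; mk⇔; Equivalence)
open import Induction.WellFounded using (Acc; acc)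
open import Relation.Binary.Definitions using (DecidableEquality; tri<; tri≈; tri>)
open import Relation.Binary.PropositionalEquality
open import Relation.Nullary.Decidable
  using (Dec; yes; no; does; ⌊_⌋; does-⇔; dec-true; dec-false; _×-dec_; ¬?; T?; toWitness; fromWitness)

import Data.Integer.Properties as ℤ
import Algebra.Lattice.Properties.BooleanAlgebra as BooleanAlgebraProperties
open import Algebra.Properties.CommutativeSemigroup ℤ.+-commutativeSemigroup
  using () renaming (interchange to +-interchange)
import Algebra.Properties.CommutativeSemigroup ℤ.*-commutativeSemigroup as *-Comm

open import Defs

𝟙 : Bool → ℤ
𝟙 true  = + 1
𝟙 false = + 0

𝟙-∧ : ∀ a b → 𝟙 (a ∧ b) ≡ 𝟙 a * 𝟙 b
𝟙-∧ true  b = sym (ℤ.*-identityˡ (𝟙 b))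
𝟙-∧ false b = refl

𝟙-≡ᵇ-refl : ∀ n → 𝟙 (n ≡ᵇ n) ≡ + 1
𝟙-≡ᵇ-refl n = cong 𝟙 (dec-true (n ℕ.≟ n) refl)

𝟙-≡ᵇ-≢ : ∀ {m n} → m ≢ n → 𝟙 (m ≡ᵇ n) ≡ + 0
𝟙-≡ᵇ-≢ {m} {n} m≢n = cong 𝟙 (dec-false (m ℕ.≟ n) m≢n)

module _ {A : Set} where

  ∑ᴸ : List A → (A → ℤ) → ℤ
  ∑ᴸ xs f = foldr _+_ (+ 0) (map f xs)

  ∑ᴸ-cong : ∀ xs {f g : A → ℤ} → (∀ x → f x ≡ g x) → ∑ᴸ xs f ≡ ∑ᴸ xs g
  ∑ᴸ-cong []       f≗g = refl
  ∑ᴸ-cong (x ∷ xs) f≗g = cong₂ _+_ (f≗g x) (∑ᴸ-cong xs f≗g)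

  ∑ᴸ-zero : ∀ xs {f : A → ℤ} → (∀ x → f x ≡ + 0) → ∑ᴸ xs f ≡ + 0
  ∑ᴸ-zero []       f≗0 = refl
  ∑ᴸ-zero (x ∷ xs) f≗0 = cong₂ _+_ (f≗0 x) (∑ᴸ-zero xs f≗0)

  ∑ᴸ-++ : ∀ xs ys (f : A → ℤ) → ∑ᴸ (xs ++ ys) f ≡ ∑ᴸ xs f + ∑ᴸ ys f
  ∑ᴸ-++ []       ys f = sym (ℤ.+-identityˡ (∑ᴸ ys f))
  ∑ᴸ-++ (x ∷ xs) ys f = trans (cong (_+_ (f x)) (∑ᴸ-++ xs ys f)) (sym (ℤ.+-assoc (f x) _ _))

  ∑ᴸ-+ : ∀ xs (f g : A → ℤ) → ∑ᴸ xs (λ x → f x + g x) ≡ ∑ᴸ xs f + ∑ᴸ xs g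
  ∑ᴸ-+ []       f g = refl
  ∑ᴸ-+ (x ∷ xs) f g = trans (cong (_+_ (f x + g x)) (∑ᴸ-+ xs f g)) (+-interchange (f x) (g x) _ _)

  ∑ᴸ-neg : ∀ xs (f : A → ℤ) → ∑ᴸ xs (λ x → - f x) ≡ - ∑ᴸ xs f
  ∑ᴸ-neg []       f = refl
  ∑ᴸ-neg (x ∷ xs) f = trans (cong (_+_ (- f x)) (∑ᴸ-neg xs f)) (sym (ℤ.neg-distrib-+ (f x) _))

  ∑ᴸ-*ˡ : ∀ xs c (f : A → ℤ) → ∑ᴸ xs (λ x → c * f x) ≡ c * ∑ᴸ xs f
  ∑ᴸ-*ˡ []       c f = sym (ℤ.*-zeroʳ c)
  ∑ᴸ-*ˡ (x ∷ xs) c f = trans (cong (_+_ (c * f x)) (∑ᴸ-*ˡ xs c f)) (sym (ℤ.*-distribˡ-+ c (f x) _))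

  length-filterᵇ : ∀ (p : A → Bool) xs → + length (filterᵇ p xs) ≡ ∑ᴸ xs (𝟙 ∘ p)
  length-filterᵇ p []       = refl
  length-filterᵇ p (x ∷ xs) with p x
  ... | true  = cong (_+_ (+ 1)) (length-filterᵇ p xs)
  ... | false = trans (length-filterᵇ p xs) (sym (ℤ.+-identityˡ _))

∑ᴸ-map : ∀ {A B : Set} (g : B → A) xs (f : A → ℤ) → ∑ᴸ (map g xs) f ≡ ∑ᴸ xs (f ∘ g)
∑ᴸ-map g xs f = cong (foldr _+_ (+ 0)) (sym (map-∘ xs))

∑ᴸ-swap : ∀ {A B : Set} xs ys (f : A → B → ℤ) →
          ∑ᴸ xs (λ x → ∑ᴸ ys (f x)) ≡ ∑ᴸ ys (λ y → ∑ᴸ xs (λ x → f x y))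
∑ᴸ-swap []       ys f = sym (∑ᴸ-zero ys (λ _ → refl))
∑ᴸ-swap (x ∷ xs) ys f =
  trans (cong (_+_ (∑ᴸ ys (f x))) (∑ᴸ-swap xs ys f)) (sym (∑ᴸ-+ ys (f x) _))

-- Defs.∑ lo hi f unfolds to ∑< (suc hi ∸ lo) (λ t → f (lo + t)).
∑< : ℕ → (ℕ → ℤ) → ℤ
∑< m = ∑ᴸ (upTo m)

∑<-suc : ∀ m f → ∑< (suc m) f ≡ f 0 + ∑< m (f ∘ suc)
∑<-suc m f = cong (λ xs → f 0 + foldr _+_ (+ 0) xs)
  (trans (map-applyUpTo suc f m) (sym (map-applyUpTo (λ i → i) (f ∘ suc) m)))

∑<-indicator : ∀ m lo v (g : ℕ → ℤ) → (v < lo → g v ≡ + 0) → (lo +ℕ m ≤ v → g v ≡ + 0) →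
               ∑< m (λ t → 𝟙 (v ≡ᵇ lo +ℕ t) * g (lo +ℕ t)) ≡ g v
∑<-indicator zero    lo v g below above with ℕ.<-≤-connex v lo
... | inj₁ v<lo = sym (below v<lo)
... | inj₂ lo≤v = sym (above (subst (_≤ v) (sym (ℕ.+-identityʳ lo)) lo≤v))
∑<-indicator (suc m) lo v g below above = begin
  ∑< (suc m) (term ∘ (lo +ℕ_))
    ≡⟨ ∑<-suc m (term ∘ (lo +ℕ_)) ⟩
  term (lo +ℕ 0) + ∑< m (λ t → term (lo +ℕ suc t))
    ≡⟨ cong₂ _+_ (cong term (ℕ.+-identityʳ lo)) (∑ᴸ-cong (upTo m) (cong term ∘ ℕ.+-suc lo)) ⟩
  term lo + ∑< m (term ∘ (suc lo +ℕ_))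
    ≡⟨ split (v ℕ.≟ lo) ⟩
  g v ∎
  where
  open ≡-Reasoning
  term : ℕ → ℤ
  term u = 𝟙 (v ≡ᵇ u) * g u
  split : Dec (v ≡ lo) → term lo + ∑< m (term ∘ (suc lo +ℕ_)) ≡ g v
  split (yes refl) = begin
    term v + ∑< m (term ∘ (suc v +ℕ_))
      ≡⟨ cong₂ _+_ (cong (_* g v) (𝟙-≡ᵇ-refl v))
                   (∑ᴸ-zero (upTo m) (λ t → cong (_* g (suc v +ℕ t))
                     (𝟙-≡ᵇ-≢ (ℕ.<⇒≢ (s≤s (ℕ.m≤m+n v t)))))) ⟩
    + 1 * g v + + 0    ≡⟨ cong (_+ + 0) (ℤ.*-identityˡ (g v)) ⟩
    g v + + 0          ≡⟨ ℤ.+-identityʳ (g v) ⟩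
    g v ∎
  split (no v≢lo) = begin
    term lo + ∑< m (term ∘ (suc lo +ℕ_))
      ≡⟨ cong₂ _+_ (cong (_* g lo) (𝟙-≡ᵇ-≢ v≢lo)) rest ⟩
    + 0 * g lo + g v ≡⟨ cong (_+ g v) (ℤ.*-zeroˡ (g lo)) ⟩
    + 0 + g v        ≡⟨ ℤ.+-identityˡ (g v) ⟩
    g v ∎
    where
    rest : ∑< m (term ∘ (suc lo +ℕ_)) ≡ g v
    rest = ∑<-indicator m (suc lo) v g
      (λ v<1+lo → below (ℕ.≤∧≢⇒< (ℕ.≤-pred v<1+lo) v≢lo))
      (λ 1+lo+m≤v → above (subst (_≤ v) (sym (ℕ.+-suc lo m)) 1+lo+m≤v))

∑<-collapse : ∀ {A : Set} m lo xs (size : A → ℕ) (w : ℕ → ℤ) (b : A → ℤ) →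
              (∀ v → v < lo → w v ≡ + 0) → (∀ x → lo +ℕ m ≤ size x → w (size x) ≡ + 0) →
              ∑< m (λ t → w (lo +ℕ t) * ∑ᴸ xs (λ x → 𝟙 (size x ≡ᵇ lo +ℕ t) * b x))
              ≡ ∑ᴸ xs (λ x → w (size x) * b x)
∑<-collapse m lo xs size w b below above = begin
  ∑< m (λ t → w (lo +ℕ t) * ∑ᴸ xs (λ x → 𝟙 (size x ≡ᵇ lo +ℕ t) * b x))
    ≡⟨ ∑ᴸ-cong (upTo m) (λ t → sym (∑ᴸ-*ˡ xs (w (lo +ℕ t)) _)) ⟩
  ∑< m (λ t → ∑ᴸ xs (λ x → w (lo +ℕ t) * (𝟙 (size x ≡ᵇ lo +ℕ t) * b x)))
    ≡⟨ ∑ᴸ-swap (upTo m) xs _ ⟩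
  ∑ᴸ xs (λ x → ∑< m (λ t → w (lo +ℕ t) * (𝟙 (size x ≡ᵇ lo +ℕ t) * b x)))
    ≡⟨ ∑ᴸ-cong xs pick ⟩
  ∑ᴸ xs (λ x → w (size x) * b x) ∎
  where
  open ≡-Reasoning
  pick : ∀ x → ∑< m (λ t → w (lo +ℕ t) * (𝟙 (size x ≡ᵇ lo +ℕ t) * b x)) ≡ w (size x) * b x
  pick x = trans
    (∑ᴸ-cong (upTo m) (λ t → *-Comm.x∙yz≈y∙xz (w (lo +ℕ t)) (𝟙 (size x ≡ᵇ lo +ℕ t)) (b x)))
    (∑<-indicator m lo (size x) (λ u → w u * b x)
      (λ v<lo → trans (cong (_* b x) (below _ v<lo)) (ℤ.*-zeroˡ (b x)))
      (λ m≤v → trans (cong (_* b x) (above x m≤v)) (ℤ.*-zeroˡ (b x))))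

-- Signed binomial sums

altBinom : ℕ → ℕ → ℤ
altBinom s i = sgn (s ∸ i) * + (s C i)

weightTerm : ℕ → ℕ → ℕ → ℕ → ℤ
weightTerm k s j i = altBinom s i * (sgn j * + ((k ∸ i) C j))

weight : ℕ → ℕ → ℕ → ℤ
weight k s j = ∑< (suc k) (weightTerm k s j)

-- weight, computed by Pascal's rule (s+1 choose i+1) = (s choose i) + (s choose i+1)
ψ : ℕ → ℕ → ℕ → ℤ
ψ k       zero    j = sgn j * + (k C j)
ψ zero    (suc s) j = - ψ zero s j
ψ (suc k) (suc s) j = ψ k s j - ψ (suc k) s j

sgn-∸-suc : ∀ {s i} → i < s → sgn (s ∸ i) ≡ - sgn (s ∸ suc i)
sgn-∸-suc (s≤s i≤s) = cong sgn (ℕ.+-∸-assoc 1 i≤s)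

altBinom-shift : ∀ s i → sgn (s ∸ i) * + (s C suc i) ≡ - altBinom s (suc i)
altBinom-shift s i with i ℕ.<? s
... | yes i<s = trans (cong (_* + (s C suc i)) (sgn-∸-suc i<s))
                     (sym (ℤ.neg-distribˡ-* (sgn (s ∸ suc i)) (+ (s C suc i))))
... | no  i≮s = begin
  sgn (s ∸ i) * + (s C suc i)          ≡⟨ cong (λ c → sgn (s ∸ i) * + c) s≺1+i ⟩
  sgn (s ∸ i) * + 0                    ≡⟨ ℤ.*-zeroʳ (sgn (s ∸ i)) ⟩
  + 0                                  ≡⟨ cong -_ (ℤ.*-zeroʳ (sgn (s ∸ suc i))) ⟨
  - (sgn (s ∸ suc i) * + 0)            ≡⟨ cong (λ c → - (sgn (s ∸ suc i) * + c)) s≺1+i ⟨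
  - (sgn (s ∸ suc i) * + (s C suc i))  ∎
  where
  open ≡-Reasoning
  s≺1+i : s C suc i ≡ 0
  s≺1+i = k>n⇒nCk≡0 (s≤s (ℕ.≮⇒≥ i≮s))

weightTerm-pascal : ∀ k s j i →
  weightTerm (suc k) (suc s) j (suc i) ≡ weightTerm k s j i + - weightTerm (suc k) s j (suc i)
weightTerm-pascal k s j i = begin
  (σ * + (suc s C suc i)) * c
    ≡⟨ cong (λ m → (σ * + m) * c) (sym (nCk+nC[k+1]≡[n+1]C[k+1] s i)) ⟩
  (σ * + (s C i ℕ.+ s C suc i)) * c
    ≡⟨ cong (λ z → (σ * z) * c) (ℤ.pos-+ (s C i) (s C suc i)) ⟩
  (σ * (+ (s C i) + + (s C suc i))) * c
    ≡⟨ cong (_* c) (ℤ.*-distribˡ-+ σ (+ (s C i)) _) ⟩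
  (σ * + (s C i) + σ * + (s C suc i)) * c
    ≡⟨ cong (λ z → (σ * + (s C i) + z) * c) (altBinom-shift s i) ⟩
  (σ * + (s C i) + - (σ′ * + (s C suc i))) * c
    ≡⟨ ℤ.*-distribʳ-+ c (σ * + (s C i)) (- (σ′ * + (s C suc i))) ⟩
  σ * + (s C i) * c + - (σ′ * + (s C suc i)) * c
    ≡⟨ cong (_+_ (σ * + (s C i) * c)) (ℤ.neg-distribˡ-* (σ′ * + (s C suc i)) c) ⟨
  σ * + (s C i) * c + - (σ′ * + (s C suc i) * c) ∎
  where
  open ≡-Reasoning
  σ σ′ c : ℤ
  σ  = sgn (s ∸ i)
  σ′ = sgn (s ∸ suc i)
  c  = sgn j * + ((k ∸ i) C j)

weight≡ψ : ∀ k s j → weight k s j ≡ ψ k s j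
weight≡ψ k zero j = begin
  weight k 0 j
    ≡⟨ ∑<-suc k (weightTerm k 0 j) ⟩
  + 1 * c + ∑< k (weightTerm k 0 j ∘ suc)
    ≡⟨ cong₂ _+_ (ℤ.*-identityˡ c) (∑ᴸ-zero (upTo k) (λ i → ℤ.*-zeroˡ (sgn j * + ((k ∸ suc i) C j)))) ⟩
  c + + 0
    ≡⟨ ℤ.+-identityʳ c ⟩
  c ∎
  where
  open ≡-Reasoning
  c : ℤ
  c = sgn j * + (k C j)
weight≡ψ zero (suc s) j =
  trans (negate (sgn s) (sgn j * + (0 C j))) (cong -_ (weight≡ψ zero s j))
  where
  negate : ∀ x c → (- x * + 1) * c + + 0 ≡ - ((x * + 1) * c + + 0)
  negate = solve-∀
weight≡ψ (suc k) (suc s) j = begin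
  weight (suc k) (suc s) j
    ≡⟨ ∑<-suc (suc k) (weightTerm (suc k) (suc s) j) ⟩
  t₀′ + ∑< (suc k) (weightTerm (suc k) (suc s) j ∘ suc)
    ≡⟨ cong (_+_ t₀′) (∑ᴸ-cong (upTo (suc k)) (weightTerm-pascal k s j)) ⟩
  t₀′ + ∑< (suc k) (λ i → weightTerm k s j i + - rest i)
    ≡⟨ cong (_+_ t₀′) (trans (∑ᴸ-+ (upTo (suc k)) (weightTerm k s j) _)
                             (cong (_+_ (weight k s j)) (∑ᴸ-neg (upTo (suc k)) rest))) ⟩
  t₀′ + (weight k s j + - ∑< (suc k) rest)
    ≡⟨ regroup (sgn s) c₀ (weight k s j) (∑< (suc k) rest) ⟩
  weight k s j - (t₀ + ∑< (suc k) rest)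
    ≡⟨ cong (_-_ (weight k s j)) (∑<-suc (suc k) (weightTerm (suc k) s j)) ⟨
  weight k s j - weight (suc k) s j
    ≡⟨ cong₂ _-_ (weight≡ψ k s j) (weight≡ψ (suc k) s j) ⟩
  ψ k s j - ψ (suc k) s j ∎
  where
  open ≡-Reasoning
  c₀ t₀ t₀′ : ℤ
  c₀  = sgn j * + (suc k C j)
  t₀  = (sgn s * + 1) * c₀
  t₀′ = (- sgn s * + 1) * c₀
  rest : ℕ → ℤ
  rest = weightTerm (suc k) s j ∘ suc
  regroup : ∀ x c w r → (- x * + 1) * c + (w + - r) ≡ w - ((x * + 1) * c + r)
  regroup = solve-∀

ψ-vanish : ∀ {k j} s → k < j → ψ k s j ≡ + 0
ψ-vanish {k} {j} zero k<j = trans (cong (λ c → sgn j * + c) (k>n⇒nCk≡0 k<j)) (ℤ.*-zeroʳ (sgn j))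
ψ-vanish {zero}  (suc s) 0<j   = cong -_ (ψ-vanish s 0<j)
ψ-vanish {suc k} (suc s) 1+k<j = cong₂ _-_ (ψ-vanish s (ℕ.<-trans (ℕ.n<1+n k) 1+k<j)) (ψ-vanish s 1+k<j)

ψ-above-size : ∀ {k s} t → s ≤ k → ψ k s (s +ℕ t) ≡ sgn t * + ((k ∸ s) C t)
ψ-above-size {k}     {zero}  t _ = refl
ψ-above-size {suc k} {suc s} t (s≤s s≤k) = begin
  ψ k s (suc (s +ℕ t)) - ψ (suc k) s (suc (s +ℕ t))
    ≡⟨ cong (λ j → ψ k s j - ψ (suc k) s j) (sym (ℕ.+-suc s t)) ⟩
  ψ k s (s +ℕ suc t) - ψ (suc k) s (s +ℕ suc t)
    ≡⟨ cong₂ _-_ (ψ-above-size (suc t) s≤k) (ψ-above-size (suc t) (ℕ.m≤n⇒m≤1+n s≤k)) ⟩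
  - sgn t * + (m C suc t) - - sgn t * + ((suc k ∸ s) C suc t)
    ≡⟨ cong (λ l → - sgn t * + (m C suc t) - - sgn t * + (l C suc t)) (ℕ.+-∸-assoc 1 s≤k) ⟩
  - sgn t * + (m C suc t) - - sgn t * + (suc m C suc t)
    ≡⟨ cong (λ c → - sgn t * + (m C suc t) - - sgn t * + c) (sym (nCk+nC[k+1]≡[n+1]C[k+1] m t)) ⟩
  - sgn t * + (m C suc t) - - sgn t * + (m C t ℕ.+ m C suc t)
    ≡⟨ cong (λ c → - sgn t * + (m C suc t) - - sgn t * c) (ℤ.pos-+ (m C t) (m C suc t)) ⟩
  - sgn t * + (m C suc t) - - sgn t * (+ (m C t) + + (m C suc t))
    ≡⟨ cancel (sgn t) (+ (m C t)) (+ (m C suc t)) ⟩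
  sgn t * + (m C t) ∎
  where
  open ≡-Reasoning
  m = k ∸ s
  cancel : ∀ x a b → - x * b - - x * (a + b) ≡ x * a
  cancel = solve-∀

ψ-diagonal : ∀ {k j} → j ≤ k → ψ k j j ≡ + 1
ψ-diagonal {k} {j} j≤k = trans (cong (ψ k j) (sym (ℕ.+-identityʳ j))) (ψ-above-size 0 j≤k)

ψ-below-diagonal : ∀ k j → ψ k (suc j) j ≡ - 𝟙 (k ≡ᵇ j)
ψ-below-diagonal zero    zero    = refl
ψ-below-diagonal (suc k) zero    = refl
ψ-below-diagonal zero    (suc j) = cong -_ (ψ-vanish (suc j) (s≤s z≤n))
ψ-below-diagonal (suc k) (suc j) with ℕ.<-cmp k j
... | tri< k<j _ _ = begin
  ψ k (suc j) (suc j) - ψ (suc k) (suc j) (suc j)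
    ≡⟨ cong₂ _-_ (ψ-vanish (suc j) (ℕ.m<n⇒m<1+n k<j)) (ψ-vanish (suc j) (s≤s k<j)) ⟩
  + 0 - + 0
    ≡⟨ cong -_ (𝟙-≡ᵇ-≢ (ℕ.<⇒≢ k<j)) ⟨
  - 𝟙 (k ≡ᵇ j) ∎
  where open ≡-Reasoning
... | tri≈ _ refl _ = begin
  ψ k (suc k) (suc k) - ψ (suc k) (suc k) (suc k)
    ≡⟨ cong₂ _-_ (ψ-vanish (suc k) (ℕ.n<1+n k)) (ψ-diagonal {suc k} ℕ.≤-refl) ⟩
  + 0 - + 1
    ≡⟨ cong -_ (𝟙-≡ᵇ-refl k) ⟨
  - 𝟙 (k ≡ᵇ k) ∎
  where open ≡-Reasoning
... | tri> _ _ j<k = begin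
  ψ k (suc j) (suc j) - ψ (suc k) (suc j) (suc j)
    ≡⟨ cong₂ _-_ (ψ-diagonal j<k) (ψ-diagonal (ℕ.m≤n⇒m≤1+n j<k)) ⟩
  + 1 - + 1
    ≡⟨ cong -_ (𝟙-≡ᵇ-≢ (ℕ.<⇒≢ j<k ∘ sym)) ⟨
  - 𝟙 (k ≡ᵇ j) ∎
  where open ≡-Reasoning

ψ-pascal : ∀ e j k → ψ k (suc (suc (e +ℕ j))) (suc j) ≡ ψ k (suc (e +ℕ j)) j + ψ k (suc (suc (e +ℕ j))) j
ψ-pascal zero j zero = begin
  ψ 0 (suc (suc j)) (suc j)
    ≡⟨ ψ-below-diagonal 0 (suc j) ⟩
  - + 0
    ≡⟨ ℤ.+-inverseʳ (- 𝟙 (0 ≡ᵇ j)) ⟨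
  - 𝟙 (0 ≡ᵇ j) + - - 𝟙 (0 ≡ᵇ j)
    ≡⟨ cong₂ _+_ (ψ-below-diagonal 0 j) (cong -_ (ψ-below-diagonal 0 j)) ⟨
  ψ 0 (suc j) j + ψ 0 (suc (suc j)) j ∎
  where open ≡-Reasoning
ψ-pascal zero j (suc k) = begin
  ψ (suc k) (suc (suc j)) (suc j)
    ≡⟨ ψ-below-diagonal (suc k) (suc j) ⟩
  - 𝟙 (k ≡ᵇ j)
    ≡⟨ regroup (𝟙 (k ≡ᵇ j)) (𝟙 (suc k ≡ᵇ j)) ⟩
  - 𝟙 (suc k ≡ᵇ j) + (- 𝟙 (k ≡ᵇ j) - - 𝟙 (suc k ≡ᵇ j))
    ≡⟨ cong₂ _+_ (ψ-below-diagonal (suc k) j) (cong₂ _-_ (ψ-below-diagonal k j) (ψ-below-diagonal (suc k) j)) ⟨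
  ψ (suc k) (suc j) j + ψ (suc k) (suc (suc j)) j ∎
  where
  open ≡-Reasoning
  regroup : ∀ a b → - a ≡ - b + (- a - - b)
  regroup = solve-∀
ψ-pascal (suc e) j zero =
  trans (cong -_ (ψ-pascal e j 0)) (ℤ.neg-distrib-+ (ψ 0 (suc (e +ℕ j)) j) (ψ 0 (suc (suc (e +ℕ j))) j))
ψ-pascal (suc e) j (suc k) =
  trans (cong₂ _-_ (ψ-pascal e j k) (ψ-pascal e j (suc k)))
        (+-minus-interchange (ψ k (suc (e +ℕ j)) j) (ψ k (suc (suc (e +ℕ j))) j)
                             (ψ (suc k) (suc (e +ℕ j)) j) (ψ (suc k) (suc (suc (e +ℕ j))) j))
  where
  +-minus-interchange : ∀ a b c d → (a + b) - (c + d) ≡ (a - c) + (b - d)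
  +-minus-interchange = solve-∀

-- intervalSum f e j = ∑ₜ (j choose t) f (e + t), the sum of f ∣ A ∣ over X ⊆ A ⊆ Y
-- when ∣ X ∣ = e and ∣ Y ─ X ∣ = j (∑ˢ-interval)
intervalSum : (ℕ → ℤ) → ℕ → ℕ → ℤ
intervalSum f e zero    = f e
intervalSum f e (suc j) = intervalSum f e j + intervalSum f (suc e) j

intervalSum-shift : ∀ f e j → intervalSum (f ∘ suc) e j ≡ intervalSum f (suc e) j
intervalSum-shift f e zero    = refl
intervalSum-shift f e (suc j) = cong₂ _+_ (intervalSum-shift f e j) (intervalSum-shift f (suc e) j)

ψ₀ : ℕ → ℕ → ℤ
ψ₀ k s = ψ k s 0

intervalSum-ψ₀-suc : ∀ k e j → intervalSum (ψ₀ k) (suc e) j ≡ ψ k (suc e +ℕ j) j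
intervalSum-ψ₀-suc k e zero    = cong (λ s → ψ k s 0) (sym (ℕ.+-identityʳ (suc e)))
intervalSum-ψ₀-suc k e (suc j) = begin
  intervalSum (ψ₀ k) (suc e) j + intervalSum (ψ₀ k) (suc (suc e)) j
    ≡⟨ cong₂ _+_ (intervalSum-ψ₀-suc k e j) (intervalSum-ψ₀-suc k (suc e) j) ⟩
  ψ k (suc (e +ℕ j)) j + ψ k (suc (suc (e +ℕ j))) j
    ≡⟨ ψ-pascal e j k ⟨
  ψ k (suc (suc (e +ℕ j))) (suc j)
    ≡⟨ cong (λ s → ψ k (suc s) (suc j)) (ℕ.+-suc e j) ⟨
  ψ k (suc (e +ℕ suc j)) (suc j) ∎
  where open ≡-Reasoning

intervalSum-ψ₀-step : ∀ k n → intervalSum (ψ₀ k) 0 (suc n) ≡ intervalSum (ψ₀ k) 0 n - 𝟙 (k ≡ᵇ n)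
intervalSum-ψ₀-step k n =
  cong (_+_ (intervalSum (ψ₀ k) 0 n)) (trans (intervalSum-ψ₀-suc k 0 n) (ψ-below-diagonal k n))

intervalSum-ψ₀-≤ : ∀ {k} n → n ≤ k → intervalSum (ψ₀ k) 0 n ≡ + 1
intervalSum-ψ₀-≤         zero    _     = refl
intervalSum-ψ₀-≤ {k} (suc n) n<k = begin
  intervalSum (ψ₀ k) 0 (suc n)       ≡⟨ intervalSum-ψ₀-step k n ⟩
  intervalSum (ψ₀ k) 0 n - 𝟙 (k ≡ᵇ n)
    ≡⟨ cong₂ _-_ (intervalSum-ψ₀-≤ n (ℕ.<⇒≤ n<k)) (𝟙-≡ᵇ-≢ (ℕ.<⇒≢ n<k ∘ sym)) ⟩
  + 1 - + 0                           ∎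
  where open ≡-Reasoning

intervalSum-ψ₀-> : ∀ {k} n → k < n → intervalSum (ψ₀ k) 0 n ≡ + 0
intervalSum-ψ₀-> {k} (suc n) k<1+n = begin
  intervalSum (ψ₀ k) 0 (suc n)       ≡⟨ intervalSum-ψ₀-step k n ⟩
  intervalSum (ψ₀ k) 0 n - 𝟙 (k ≡ᵇ n) ≡⟨ last (ℕ.m≤n⇒m<n∨m≡n (ℕ.≤-pred k<1+n)) ⟩
  + 0                                 ∎
  where
  open ≡-Reasoning
  last : k < n ⊎ k ≡ n → intervalSum (ψ₀ k) 0 n - 𝟙 (k ≡ᵇ n) ≡ + 0
  last (inj₁ k<n)  = cong₂ _-_ (intervalSum-ψ₀-> n k<n) (𝟙-≡ᵇ-≢ (ℕ.<⇒≢ k<n))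
  last (inj₂ refl) = cong₂ _-_ (intervalSum-ψ₀-≤ k ℕ.≤-refl) (𝟙-≡ᵇ-refl k)

intervalSum-ψ₀ : ∀ k e j → (e ≡ 0 → j ≡ 0) → intervalSum (ψ₀ k) e j ≡ ψ k (e +ℕ j) j
intervalSum-ψ₀ k (suc e) j _ = intervalSum-ψ₀-suc k e j
intervalSum-ψ₀ k zero    j j≡0 with j≡0 refl
... | refl = refl

∑ˢ : ∀ n → (Subset n → ℤ) → ℤ
∑ˢ n = ∑ᴸ (allSubsets n)

∑ˢ-suc : ∀ n (f : Subset (suc n) → ℤ) →
         ∑ˢ (suc n) f ≡ ∑ˢ n (f ∘ (outside ∷_)) + ∑ˢ n (f ∘ (inside ∷_))
∑ˢ-suc n f = trans (∑ᴸ-++ (map (outside ∷_) (allSubsets n)) (map (inside ∷_) (allSubsets n)) f)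
                   (cong₂ _+_ (∑ᴸ-map (outside ∷_) (allSubsets n) f) (∑ᴸ-map (inside ∷_) (allSubsets n) f))

∑ˢ-size : ∀ n (f : ℕ → ℤ) → ∑ˢ n (λ A → f ∣ A ∣) ≡ intervalSum f 0 n
∑ˢ-size zero    f = ℤ.+-identityʳ (f 0)
∑ˢ-size (suc n) f = trans (∑ˢ-suc n (λ A → f ∣ A ∣))
  (cong₂ _+_ (∑ˢ-size n f) (trans (∑ˢ-size n (f ∘ suc)) (intervalSum-shift f 0 n)))

_≟ˢ_ : ∀ {n} → DecidableEquality (Subset n)
_≟ˢ_ = ≡-dec Bool._≟_

∑ˢ-point : ∀ n (D : Subset n) (g : Subset n → ℤ) → ∑ˢ n (λ A → 𝟙 (does (D ≟ˢ A)) * g A) ≡ g D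
∑ˢ-point zero    []            g = trans (ℤ.+-identityʳ _) (ℤ.*-identityˡ (g []))
∑ˢ-point (suc n) (outside ∷ D) g = begin
  ∑ˢ (suc n) (λ A → 𝟙 (does ((outside ∷ D) ≟ˢ A)) * g A)
    ≡⟨ ∑ˢ-suc n (λ A → 𝟙 (does ((outside ∷ D) ≟ˢ A)) * g A) ⟩
  ∑ˢ n (λ A → 𝟙 (does (D ≟ˢ A)) * g (outside ∷ A)) + ∑ˢ n (λ A → + 0 * g (inside ∷ A))
    ≡⟨ cong₂ _+_ (∑ˢ-point n D (g ∘ (outside ∷_)))
                 (∑ᴸ-zero (allSubsets n) (λ A → ℤ.*-zeroˡ (g (inside ∷ A)))) ⟩
  g (outside ∷ D) + + 0
    ≡⟨ ℤ.+-identityʳ _ ⟩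
  g (outside ∷ D) ∎
  where open ≡-Reasoning
∑ˢ-point (suc n) (inside ∷ D) g = begin
  ∑ˢ (suc n) (λ A → 𝟙 (does ((inside ∷ D) ≟ˢ A)) * g A)
    ≡⟨ ∑ˢ-suc n (λ A → 𝟙 (does ((inside ∷ D) ≟ˢ A)) * g A) ⟩
  ∑ˢ n (λ A → + 0 * g (outside ∷ A)) + ∑ˢ n (λ A → 𝟙 (does (D ≟ˢ A)) * g (inside ∷ A))
    ≡⟨ cong₂ _+_ (∑ᴸ-zero (allSubsets n) (λ A → ℤ.*-zeroˡ (g (outside ∷ A))))
                 (∑ˢ-point n D (g ∘ (inside ∷_))) ⟩
  + 0 + g (inside ∷ D)
    ≡⟨ ℤ.+-identityˡ _ ⟩
  g (inside ∷ D) ∎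
  where open ≡-Reasoning

∑ˢ-interval : ∀ n (X Y : Subset n) (f : ℕ → ℤ) → X ⊆ Y →
  ∑ˢ n (λ A → 𝟙 (does (X ⊆? A) ∧ does (A ⊆? Y)) * f ∣ A ∣) ≡ intervalSum f ∣ X ∣ ∣ Y ─ X ∣
∑ˢ-interval zero [] [] f _ = trans (ℤ.+-identityʳ _) (ℤ.*-identityˡ (f 0))
∑ˢ-interval (suc n) (outside ∷ X) (outside ∷ Y) f X⊆Y = begin
  ∑ˢ (suc n) (λ A → 𝟙 (does ((outside ∷ X) ⊆? A) ∧ does (A ⊆? (outside ∷ Y))) * f ∣ A ∣)
    ≡⟨ ∑ˢ-suc n _ ⟩
  ∑ˢ n (λ A → 𝟙 (does (X ⊆? A) ∧ does (A ⊆? Y)) * f ∣ A ∣)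
    + ∑ˢ n (λ A → 𝟙 (does (X ⊆? A) ∧ false) * f (suc ∣ A ∣))
    ≡⟨ cong₂ _+_ (∑ˢ-interval n X Y f (drop-∷-⊆ X⊆Y)) (∑ᴸ-zero (allSubsets n) excluded) ⟩
  intervalSum f (∣ X ∣) (∣ Y ─ X ∣) + + 0
    ≡⟨ ℤ.+-identityʳ _ ⟩
  intervalSum f (∣ X ∣) (∣ Y ─ X ∣) ∎
  where
  open ≡-Reasoning
  excluded : ∀ A → 𝟙 (does (X ⊆? A) ∧ false) * f (suc ∣ A ∣) ≡ + 0
  excluded A = trans (cong (λ b → 𝟙 b * f (suc ∣ A ∣)) (∧-zeroʳ (does (X ⊆? A))))
                     (ℤ.*-zeroˡ (f (suc ∣ A ∣)))
∑ˢ-interval (suc n) (inside ∷ X) (inside ∷ Y) f X⊆Y = begin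
  ∑ˢ (suc n) (λ A → 𝟙 (does ((inside ∷ X) ⊆? A) ∧ does (A ⊆? (inside ∷ Y))) * f ∣ A ∣)
    ≡⟨ ∑ˢ-suc n _ ⟩
  ∑ˢ n (λ A → + 0 * f ∣ A ∣) + ∑ˢ n (λ A → 𝟙 (does (X ⊆? A) ∧ does (A ⊆? Y)) * f (suc ∣ A ∣))
    ≡⟨ cong₂ _+_ (∑ᴸ-zero (allSubsets n) (λ A → ℤ.*-zeroˡ (f ∣ A ∣)))
                 (∑ˢ-interval n X Y (f ∘ suc) (drop-∷-⊆ X⊆Y)) ⟩
  + 0 + intervalSum (f ∘ suc) (∣ X ∣) (∣ Y ─ X ∣)
    ≡⟨ ℤ.+-identityˡ _ ⟩
  intervalSum (f ∘ suc) (∣ X ∣) (∣ Y ─ X ∣)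
    ≡⟨ intervalSum-shift f ∣ X ∣ ∣ Y ─ X ∣ ⟩
  intervalSum f (suc ∣ X ∣) (∣ Y ─ X ∣) ∎
  where open ≡-Reasoning
∑ˢ-interval (suc n) (outside ∷ X) (inside ∷ Y) f X⊆Y = trans (∑ˢ-suc n _)
  (cong₂ _+_ (∑ˢ-interval n X Y f (drop-∷-⊆ X⊆Y))
             (trans (∑ˢ-interval n X Y (f ∘ suc) (drop-∷-⊆ X⊆Y)) (intervalSum-shift f ∣ X ∣ ∣ Y ─ X ∣)))
∑ˢ-interval (suc n) (inside ∷ X) (outside ∷ Y) f X⊆Y with X⊆Y Vec.here
... | ()

∈-allSubsets : ∀ {n} (D : Subset n) → D ∈ᴸ allSubsets n
∈-allSubsets []                = here refl
∈-allSubsets (outside ∷ D)     = ∈-++⁺ˡ (∈-map⁺ (outside ∷_) (∈-allSubsets D))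
∈-allSubsets {suc n} (inside ∷ D) =
  ∈-++⁺ʳ (map (outside ∷_) (allSubsets n)) (∈-map⁺ (inside ∷_) (∈-allSubsets D))

⋂-⊆ : ∀ {n} {D : Subset n} {Ds} → D ∈ᴸ Ds → ⋂ Ds ⊆ D
⋂-⊆ {Ds = D ∷ Ds} (here refl) = p∩q⊆p D (⋂ Ds)
⋂-⊆ {Ds = E ∷ Ds} (there D∈Ds) = ⊆-trans (p∩q⊆q E (⋂ Ds)) (⋂-⊆ D∈Ds)

⊆-⋂ : ∀ {n} {A : Subset n} Ds → (∀ {D} → D ∈ᴸ Ds → A ⊆ D) → A ⊆ ⋂ Ds
⊆-⋂ []       _       _   = ∈⊤
⊆-⋂ (D ∷ Ds) A⊆Ds x∈A = x∈p∩q⁺ (A⊆Ds (here refl) x∈A , ⊆-⋂ Ds (A⊆Ds ∘ there) x∈A)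

x∈p─q⇒x∉q : ∀ {n} {x : Fin n} (p q : Subset n) → x ∈ p ─ q → x ∉ q
x∈p─q⇒x∉q (inside  ∷ p) (outside ∷ q) Vec.here ()
x∈p─q⇒x∉q (_       ∷ p) (_       ∷ q) (Vec.there x∈p─q) (Vec.there x∈q) = x∈p─q⇒x∉q p q x∈p─q x∈q

p─[p─q]≡q : ∀ {n} (p q : Subset n) → q ⊆ p → p ─ (p ─ q) ≡ q
p─[p─q]≡q []            []            _   = refl
p─[p─q]≡q (inside  ∷ p) (inside  ∷ q) q⊆p = cong (inside ∷_) (p─[p─q]≡q p q (drop-∷-⊆ q⊆p))
p─[p─q]≡q (inside  ∷ p) (outside ∷ q) q⊆p = cong (outside ∷_) (p─[p─q]≡q p q (drop-∷-⊆ q⊆p))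
p─[p─q]≡q (outside ∷ p) (outside ∷ q) q⊆p = cong (outside ∷_) (p─[p─q]≡q p q (drop-∷-⊆ q⊆p))
p─[p─q]≡q (outside ∷ p) (inside  ∷ q) q⊆p with q⊆p Vec.here
... | ()

∣p∣≡∣p─q∣+∣q∣ : ∀ {n} (p q : Subset n) → q ⊆ p → ∣ p ∣ ≡ ∣ p ─ q ∣ +ℕ ∣ q ∣
∣p∣≡∣p─q∣+∣q∣ []            []            _   = refl
∣p∣≡∣p─q∣+∣q∣ (inside  ∷ p) (inside  ∷ q) q⊆p =
  trans (cong suc (∣p∣≡∣p─q∣+∣q∣ p q (drop-∷-⊆ q⊆p))) (sym (ℕ.+-suc _ _))
∣p∣≡∣p─q∣+∣q∣ (inside  ∷ p) (outside ∷ q) q⊆p = cong suc (∣p∣≡∣p─q∣+∣q∣ p q (drop-∷-⊆ q⊆p))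
∣p∣≡∣p─q∣+∣q∣ (outside ∷ p) (outside ∷ q) q⊆p = ∣p∣≡∣p─q∣+∣q∣ p q (drop-∷-⊆ q⊆p)
∣p∣≡∣p─q∣+∣q∣ (outside ∷ p) (inside  ∷ q) q⊆p with q⊆p Vec.here
... | ()

∣p∣≡0⇒x∉p : ∀ {n} {p : Subset n} {x} → ∣ p ∣ ≡ 0 → x ∉ p
∣p∣≡0⇒x∉p {p = outside ∷ p} ∣p∣≡0 (Vec.there x∈p) = ∣p∣≡0⇒x∉p ∣p∣≡0 x∈p

∁[p-x]≡∁p∪⁅x⁆ : ∀ {n} (p : Subset n) x → ∁ (p ─ ⁅ x ⁆) ≡ ∁ p ∪ ⁅ x ⁆
∁[p-x]≡∁p∪⁅x⁆ (inside  ∷ p) zero = cong (inside ∷_) (trans (cong ∁ (p─⊥≡p p)) (sym (∪-identityʳ (∁ p))))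
∁[p-x]≡∁p∪⁅x⁆ (outside ∷ p) zero = cong (inside ∷_) (trans (cong ∁ (p─⊥≡p p)) (sym (∪-identityʳ (∁ p))))
∁[p-x]≡∁p∪⁅x⁆ (inside  ∷ p) (suc x) = cong (outside ∷_) (∁[p-x]≡∁p∪⁅x⁆ p x)
∁[p-x]≡∁p∪⁅x⁆ (outside ∷ p) (suc x) = cong (inside ∷_) (∁[p-x]≡∁p∪⁅x⁆ p x)

∈-tabulate : ∀ {n} {f : Fin n → Bool} {x} → x ∈ tabulate f ⇔ f x ≡ inside
∈-tabulate {f = f} {x} = mk⇔
  (λ x∈ → trans (sym (lookup∘tabulate f x)) ([]=⇒lookup x∈))
  (λ fx → lookup⇒[]= x (tabulate f) (trans (lookup∘tabulate f x) fx))

decide-inside : {P Q : Set} (P? : Dec P) (Q? : Dec Q) →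
                (if ⌊ P? ⌋ ∧ ⌊ Q? ⌋ then inside else outside) ≡ inside ⇔ (P × Q)
decide-inside (yes p) (yes q) = mk⇔ (λ _ → p , q) (λ _ → refl)
decide-inside (yes p) (no ¬q) = mk⇔ (λ ()) (⊥-elim ∘ ¬q ∘ proj₂)
decide-inside (no ¬p) _       = mk⇔ (λ ()) (⊥-elim ∘ ¬p ∘ proj₁)

-- Counting convex sets by size and interior size

module Counting {n : ℕ} (F : Family n) where

  interiorSize : Subset n → ℕ
  interiorSize K = ∣ interior F K ∣

  a≡∑ˢ : ∀ s j → + a F s j ≡ ∑ˢ n (λ K → 𝟙 (∣ K ∣ ≡ᵇ s) * (𝟙 (convex F K) * 𝟙 (interiorSize K ≡ᵇ j)))
  a≡∑ˢ s j = trans (length-filterᵇ _ (allSubsets n)) (∑ᴸ-cong (allSubsets n) reorder)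
    where
    reorder : ∀ K → 𝟙 (convex F K ∧ (∣ K ∣ ≡ᵇ s) ∧ (interiorSize K ≡ᵇ j))
                    ≡ 𝟙 (∣ K ∣ ≡ᵇ s) * (𝟙 (convex F K) * 𝟙 (interiorSize K ≡ᵇ j))
    reorder K = begin
      𝟙 (convex F K ∧ (∣ K ∣ ≡ᵇ s) ∧ (interiorSize K ≡ᵇ j))
        ≡⟨ 𝟙-∧ (convex F K) _ ⟩
      𝟙 (convex F K) * 𝟙 ((∣ K ∣ ≡ᵇ s) ∧ (interiorSize K ≡ᵇ j))
        ≡⟨ cong (_*_ (𝟙 (convex F K))) (𝟙-∧ (∣ K ∣ ≡ᵇ s) _) ⟩
      𝟙 (convex F K) * (𝟙 (∣ K ∣ ≡ᵇ s) * 𝟙 (interiorSize K ≡ᵇ j))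
        ≡⟨ *-Comm.x∙yz≈y∙xz (𝟙 (convex F K)) (𝟙 (∣ K ∣ ≡ᵇ s)) _ ⟩
      𝟙 (∣ K ∣ ≡ᵇ s) * (𝟙 (convex F K) * 𝟙 (interiorSize K ≡ᵇ j)) ∎
      where open ≡-Reasoning

  ∑ₛa≡∑ˢ : ∀ i j → ∑ i n (λ s → sgn (s ∸ i) * (+ (s C i) * + a F s j))
                    ≡ ∑ˢ n (λ K → altBinom ∣ K ∣ i * (𝟙 (convex F K) * 𝟙 (interiorSize K ≡ᵇ j)))
  ∑ₛa≡∑ˢ i j = begin
    ∑< m (λ t → sgn (i +ℕ t ∸ i) * (+ ((i +ℕ t) C i) * + a F (i +ℕ t) j))
      ≡⟨ ∑ᴸ-cong (upTo m) (λ t → trans (sym (ℤ.*-assoc (sgn (i +ℕ t ∸ i)) _ _))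
                                      (cong (_*_ (altBinom (i +ℕ t) i)) (a≡∑ˢ (i +ℕ t) j))) ⟩
    ∑< m (λ t → altBinom (i +ℕ t) i * ∑ˢ n (λ K → 𝟙 (∣ K ∣ ≡ᵇ i +ℕ t) * b K))
      ≡⟨ ∑<-collapse m i (allSubsets n) ∣_∣ (λ s → altBinom s i) b below above ⟩
    ∑ˢ n (λ K → altBinom ∣ K ∣ i * b K) ∎
    where
    open ≡-Reasoning
    m : ℕ
    m = suc n ∸ i
    b : Subset n → ℤ
    b K = 𝟙 (convex F K) * 𝟙 (interiorSize K ≡ᵇ j)
    below : ∀ s → s < i → altBinom s i ≡ + 0
    below s s<i = trans (cong (λ c → sgn (s ∸ i) * + c) (k>n⇒nCk≡0 s<i)) (ℤ.*-zeroʳ (sgn (s ∸ i)))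
    above : ∀ K → i +ℕ m ≤ ∣ K ∣ → altBinom ∣ K ∣ i ≡ + 0
    above K i+m≤∣K∣ = ⊥-elim (ℕ.<-irrefl refl
      (ℕ.≤-trans (ℕ.≤-trans (ℕ.m≤n+m∸n (suc n) i) i+m≤∣K∣) (∣p∣≤n K)))

  ∑ⱼ∑ₛa≡∑ˢ : ∀ k i →
    ∑ 0 (k ∸ i) (λ j → (sgn j * + ((k ∸ i) C j)) * ∑ i n (λ s → sgn (s ∸ i) * (+ (s C i) * + a F s j)))
    ≡ ∑ˢ n (λ K → (sgn (interiorSize K) * + ((k ∸ i) C interiorSize K)) * (altBinom ∣ K ∣ i * 𝟙 (convex F K)))
  ∑ⱼ∑ₛa≡∑ˢ k i = begin
    ∑< (suc (k ∸ i)) (λ j → c j * ∑ i n (λ s → sgn (s ∸ i) * (+ (s C i) * + a F s j)))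
      ≡⟨ ∑ᴸ-cong (upTo (suc (k ∸ i))) (λ j → cong (_*_ (c j)) (trans (∑ₛa≡∑ˢ i j)
           (∑ᴸ-cong (allSubsets n) (λ K → *-Comm.x∙yz≈z∙xy (altBinom ∣ K ∣ i) (𝟙 (convex F K)) _)))) ⟩
    ∑< (suc (k ∸ i)) (λ j → c j * ∑ˢ n (λ K → 𝟙 (interiorSize K ≡ᵇ j) * b K))
      ≡⟨ ∑<-collapse (suc (k ∸ i)) 0 (allSubsets n) interiorSize c b (λ _ ()) above ⟩
    ∑ˢ n (λ K → c (interiorSize K) * b K) ∎
    where
    open ≡-Reasoning
    c : ℕ → ℤ
    c j = sgn j * + ((k ∸ i) C j)
    b : Subset n → ℤ
    b K = altBinom ∣ K ∣ i * 𝟙 (convex F K)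
    above : ∀ K → suc (k ∸ i) ≤ interiorSize K → c (interiorSize K) ≡ + 0
    above K k∸i<j = trans (cong (λ m → sgn (interiorSize K) * + m) (k>n⇒nCk≡0 k∸i<j))
                          (ℤ.*-zeroʳ (sgn (interiorSize K)))

  E≡∑weight : ∀ k → E F k ≡ ∑ˢ n (λ K → 𝟙 (convex F K) * weight k ∣ K ∣ (interiorSize K))
  E≡∑weight k = begin
    E F k
      ≡⟨ ∑ᴸ-cong (upTo (suc k)) (∑ⱼ∑ₛa≡∑ˢ k) ⟩
    ∑< (suc k) (λ i → ∑ˢ n (λ K → c i (interiorSize K) * (altBinom ∣ K ∣ i * 𝟙 (convex F K))))
      ≡⟨ ∑ᴸ-swap (upTo (suc k)) (allSubsets n) _ ⟩
    ∑ˢ n (λ K → ∑< (suc k) (λ i → c i (interiorSize K) * (altBinom ∣ K ∣ i * 𝟙 (convex F K))))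
      ≡⟨ ∑ᴸ-cong (allSubsets n) (λ K → trans
           (∑ᴸ-cong (upTo (suc k)) (λ i → *-Comm.x∙yz≈z∙yx (c i (interiorSize K)) (altBinom ∣ K ∣ i) _))
           (∑ᴸ-*ˡ (upTo (suc k)) (𝟙 (convex F K)) (weightTerm k ∣ K ∣ (interiorSize K)))) ⟩
    ∑ˢ n (λ K → 𝟙 (convex F K) * weight k ∣ K ∣ (interiorSize K)) ∎
    where
    open ≡-Reasoning
    c : ℕ → ℕ → ℤ
    c i j = sgn j * + ((k ∸ i) C j)

-- Closure and extreme points in an antimatroid

module Antimatroid {n : ℕ} {F : Family n} (isAntimatroid : IsAntimatroid F) where
  open IsAntimatroid isAntimatroid
  private module BA = BooleanAlgebraProperties (∪-∩-booleanAlgebra n)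

  Feasible Convex : Subset n → Set
  Feasible A = F A ≡ true
  Convex K = convex F K ≡ true

  ⊥-convex : Convex ⊥
  ⊥-convex = subst Feasible (sym BA.¬⊥≈⊤) full-feasible

  ⋂-convex : ∀ Ds → (∀ {D} → D ∈ᴸ Ds → Convex D) → Convex (⋂ Ds)
  ⋂-convex []       _         = subst Feasible (sym BA.¬⊤≈⊥) empty-feasible
  ⋂-convex (D ∷ Ds) convex-Ds = subst Feasible (sym (BA.deMorgan₁ D (⋂ Ds)))
    (union-closed (∁ D) (∁ (⋂ Ds)) (convex-Ds (here refl)) (⋂-convex Ds (convex-Ds ∘ there)))

  candidates : Subset n → List (Subset n)
  candidates A = filterᵇ (λ D → ⌊ A ⊆? D ⌋ ∧ convex F D) (allSubsets n)

  ∈-candidates⁻ : ∀ {A D} → D ∈ᴸ candidates A → A ⊆ D × Convex D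
  ∈-candidates⁻ {A} {D} D∈
    with Equivalence.to T-∧ (proj₂ (∈-filter⁻ (λ E → T? (⌊ A ⊆? E ⌋ ∧ convex F E)) {xs = allSubsets n} D∈))
  ... | A⊆D , convex-D = (λ {x} → toWitness {a? = A ⊆? D} A⊆D {x}) , Equivalence.to T-≡ convex-D

  ∈-candidates⁺ : ∀ {A D} → A ⊆ D → Convex D → D ∈ᴸ candidates A
  ∈-candidates⁺ {A} {D} A⊆D convex-D =
    ∈-filter⁺ (λ E → T? (⌊ A ⊆? E ⌋ ∧ convex F E)) (∈-allSubsets D)
      (Equivalence.from T-∧ (fromWitness {a? = A ⊆? D} (λ {x} → A⊆D {x}) , Equivalence.from T-≡ convex-D))

  closure-extensive : ∀ A → A ⊆ closure F A
  closure-extensive A = ⊆-⋂ (candidates A) (proj₁ ∘ ∈-candidates⁻)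

  closure-least : ∀ {A K} → A ⊆ K → Convex K → closure F A ⊆ K
  closure-least A⊆K convex-K = ⋂-⊆ (∈-candidates⁺ A⊆K convex-K)

  closure-convex : ∀ A → Convex (closure F A)
  closure-convex A = ⋂-convex (candidates A) (proj₂ ∘ ∈-candidates⁻)

  closure-mono : ∀ {A B} → A ⊆ B → closure F A ⊆ closure F B
  closure-mono {A} {B} A⊆B = closure-least (⊆-trans A⊆B (closure-extensive B)) (closure-convex B)

  -- Peel accessible points off Y while some other point of Y lies outside X; once the peeled
  -- point is the last one outside X, X ∪ Y = X ∪ ⁅ p ⁆.
  augmentation : ∀ {X Y p} → Feasible X → Feasible Y → p ∈ Y → p ∉ X → Acc _<_ ∣ Y ∣ →
                 ∃ λ q → q ∈ Y × q ∉ X × Feasible (X ∪ ⁅ q ⁆)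
  augmentation {X} {Y} {p} F-X F-Y p∈Y p∉X (acc smaller) with accessible Y F-Y (p , p∈Y)
  ... | y , y∈Y , F-Y-y with any? (λ q → q ∈? Y ─ ⁅ y ⁆ ×-dec ¬? (q ∈? X))
  ...   | yes (p′ , p′∈Y-y , p′∉X) =
    let q , q∈Y-y , q∉X , F-X+q = augmentation F-X F-Y-y p′∈Y-y p′∉X (smaller (x∈p⇒∣p-x∣<∣p∣ y∈Y))
    in  q , p─q⊆p Y ⁅ y ⁆ q∈Y-y , q∉X , F-X+q
  ...   | no ∄ = p , p∈Y , p∉X , subst Feasible (sym X∪⁅p⁆≡X∪Y) (union-closed X Y F-X F-Y)
    where
    Y-y⊆X : Y ─ ⁅ y ⁆ ⊆ X
    Y-y⊆X {z} z∈Y-y with z ∈? X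
    ... | yes z∈X = z∈X
    ... | no  z∉X = ⊥-elim (∄ (z , z∈Y-y , z∉X))
    Y⊆X∪⁅p⁆ : Y ⊆ X ∪ ⁅ p ⁆
    Y⊆X∪⁅p⁆ {z} z∈Y with z Fin.≟ p
    ... | yes refl = x∈p∪q⁺ (inj₂ (x∈⁅x⁆ z))
    ... | no  z≢p  with z Fin.≟ y
    ...   | yes refl = ⊥-elim (p∉X (Y-y⊆X (x∈p∧x≢y⇒x∈p-y p∈Y (z≢p ∘ sym))))
    ...   | no  z≢y  = x∈p∪q⁺ (inj₁ (Y-y⊆X (x∈p∧x≢y⇒x∈p-y z∈Y z≢y)))
    ⁅p⁆⊆Y : ⁅ p ⁆ ⊆ Y
    ⁅p⁆⊆Y z∈⁅p⁆ = subst (_∈ Y) (sym (x∈⁅y⁆⇒x≡y p z∈⁅p⁆)) p∈Y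
    X∪⁅p⁆≡X∪Y : X ∪ ⁅ p ⁆ ≡ X ∪ Y
    X∪⁅p⁆≡X∪Y = ⊆-antisym
      (λ z∈ → x∈p∪q⁺ (Sum.map₂ ⁅p⁆⊆Y (x∈p∪q⁻ X ⁅ p ⁆ z∈)))
      (λ z∈ → Sum.[ p⊆p∪q ⁅ p ⁆ , Y⊆X∪⁅p⁆ ] (x∈p∪q⁻ X Y z∈))

  extreme : Subset n → Subset n
  extreme K = K ─ interior F K

  ∈-interior : ∀ {K p} → p ∈ interior F K ⇔ (p ∈ K × p ∈ closure F (K ─ ⁅ p ⁆))
  ∈-interior {K} {p} =
    mk⇔ (to (decide-inside P? Q?) ∘ to ∈-tabulate) (from ∈-tabulate ∘ from (decide-inside P? Q?))
    where
    open Equivalence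
    P? : Dec (p ∈ K)
    P? = p ∈? K
    Q? : Dec (p ∈ closure F (K ─ ⁅ p ⁆))
    Q? = p ∈? closure F (K ─ ⁅ p ⁆)

  interior⊆ : ∀ K → interior F K ⊆ K
  interior⊆ K = proj₁ ∘ Equivalence.to ∈-interior

  -- A point z ∈ K outside D = closure (extreme K) lets ∁ K be augmented from ∁ D by some q ∈ K ─ D;
  -- then K ─ ⁅ q ⁆ is convex, so q is an extreme point outside D.
  krein-milman : ∀ {K} → Convex K → K ⊆ closure F (extreme K)
  krein-milman {K} convex-K {z} z∈K with z ∈? closure F (extreme K)
  ... | yes z∈D = z∈D
  ... | no  z∉D with augmentation convex-K (closure-convex (extreme K)) (x∉p⇒x∈∁p z∉D) (x∈p⇒x∉∁p z∈K)
                                  (<-wellFounded _)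
  ...   | q , q∈∁D , q∉∁K , F[∁K∪q] = ⊥-elim (x∈∁p⇒x∉p q∈∁D (closure-extensive (extreme K) q∈extreme))
    where
    K-q-convex : Convex (K ─ ⁅ q ⁆)
    K-q-convex = subst Feasible (sym (∁[p-x]≡∁p∪⁅x⁆ K q)) F[∁K∪q]
    q∉interior : q ∉ interior F K
    q∉interior q∈int = x∈p─q⇒x∉q K ⁅ q ⁆
      (closure-least (λ x∈ → x∈) K-q-convex (proj₂ (Equivalence.to ∈-interior q∈int))) (x∈⁅x⁆ q)
    q∈extreme : q ∈ extreme K
    q∈extreme = x∈p∧x∉q⇒x∈p─q (x∉∁p⇒x∈p q∉∁K) q∉interior

  closure≡⇔ : ∀ {A K} → Convex K → closure F A ≡ K ⇔ (extreme K ⊆ A × A ⊆ K)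
  closure≡⇔ {A} {K} convex-K = mk⇔ to from
    where
    to : closure F A ≡ K → extreme K ⊆ A × A ⊆ K
    to closure≡K = extreme⊆A , A⊆K
      where
      A⊆K : A ⊆ K
      A⊆K x∈A = subst (_ ∈_) closure≡K (closure-extensive A x∈A)
      extreme⊆A : extreme K ⊆ A
      extreme⊆A {p} p∈ext with p ∈? A
      ... | yes p∈A = p∈A
      ... | no  p∉A = ⊥-elim (x∈p─q⇒x∉q K (interior F K) p∈ext (Equivalence.from ∈-interior (p∈K , p∈closure)))
        where
        p∈K : p ∈ K
        p∈K = p─q⊆p K (interior F K) p∈ext
        A⊆K-p : A ⊆ K ─ ⁅ p ⁆
        A⊆K-p {x} x∈A = x∈p∧x≢y⇒x∈p-y (A⊆K x∈A) (λ { refl → p∉A x∈A })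
        p∈closure : p ∈ closure F (K ─ ⁅ p ⁆)
        p∈closure = closure-mono A⊆K-p (subst (p ∈_) (sym closure≡K) p∈K)
    from : extreme K ⊆ A × A ⊆ K → closure F A ≡ K
    from (extreme⊆A , A⊆K) =
      ⊆-antisym (closure-least A⊆K convex-K) (⊆-trans (krein-milman convex-K) (closure-mono extreme⊆A))

  no-extreme⇒no-interior : ∀ {K} → Convex K → ∣ extreme K ∣ ≡ 0 → ∣ interior F K ∣ ≡ 0
  no-extreme⇒no-interior {K} convex-K ∣ext∣≡0 =
    ℕ.n≤0⇒n≡0 (ℕ.≤-trans (p⊆q⇒∣p∣≤∣q∣ interior⊆⊥) (ℕ.≤-reflexive (∣⊥∣≡0 n)))
    where
    interior⊆⊥ : interior F K ⊆ ⊥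
    interior⊆⊥ = ⊆-trans (interior⊆ K) (⊆-trans (krein-milman convex-K)
      (closure-least (λ x∈ → ⊥-elim (∣p∣≡0⇒x∉p ∣ext∣≡0 x∈)) ⊥-convex))

-- Summing over the fibres of the closure map

module _ {n : ℕ} {F : Family n} (isAntimatroid : IsAntimatroid F) where
  open Antimatroid isAntimatroid
  open Counting F

  inFibre : Subset n → Subset n → ℤ
  inFibre K A = 𝟙 (does (closure F A ≟ˢ K))

  ∑-fibre : ∀ k {K} → Convex K → ∑ˢ n (λ A → inFibre K A * ψ₀ k ∣ A ∣) ≡ ψ k ∣ K ∣ (interiorSize K)
  ∑-fibre k {K} convex-K = begin
    ∑ˢ n (λ A → inFibre K A * ψ₀ k ∣ A ∣)
      ≡⟨ ∑ᴸ-cong (allSubsets n) (λ A → cong (λ b → 𝟙 b * ψ₀ k ∣ A ∣)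
           (does-⇔ (closure≡⇔ convex-K) (closure F A ≟ˢ K) (extreme K ⊆? A ×-dec A ⊆? K))) ⟩
    ∑ˢ n (λ A → 𝟙 (does (extreme K ⊆? A) ∧ does (A ⊆? K)) * ψ₀ k ∣ A ∣)
      ≡⟨ ∑ˢ-interval n (extreme K) K (ψ₀ k) (p─q⊆p K (interior F K)) ⟩
    intervalSum (ψ₀ k) e (∣ K ─ extreme K ∣)
      ≡⟨ cong (intervalSum (ψ₀ k) e ∘ ∣_∣) (p─[p─q]≡q K (interior F K) (interior⊆ K)) ⟩
    intervalSum (ψ₀ k) e (interiorSize K)
      ≡⟨ intervalSum-ψ₀ k e (interiorSize K) (no-extreme⇒no-interior convex-K) ⟩
    ψ k (e +ℕ interiorSize K) (interiorSize K)
      ≡⟨ cong (λ s → ψ k s (interiorSize K)) (∣p∣≡∣p─q∣+∣q∣ K (interior F K) (interior⊆ K)) ⟨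
    ψ k ∣ K ∣ (interiorSize K) ∎
    where
    open ≡-Reasoning
    e : ℕ
    e = ∣ extreme K ∣

  convex-∑-fibre : ∀ k K → 𝟙 (convex F K) * ∑ˢ n (λ A → inFibre K A * ψ₀ k ∣ A ∣)
                           ≡ 𝟙 (convex F K) * ψ k ∣ K ∣ (interiorSize K)
  convex-∑-fibre k K with convex F K in convex-K
  ... | true  = cong (_*_ (+ 1)) (∑-fibre k convex-K)
  ... | false = trans (ℤ.*-zeroˡ (∑ˢ n (λ A → inFibre K A * ψ₀ k ∣ A ∣)))
                      (sym (ℤ.*-zeroˡ (ψ k ∣ K ∣ (interiorSize K))))

  ∑ψ₀≡∑ψ : ∀ k → ∑ˢ n (λ A → ψ₀ k ∣ A ∣) ≡ ∑ˢ n (λ K → 𝟙 (convex F K) * ψ k ∣ K ∣ (interiorSize K))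
  ∑ψ₀≡∑ψ k = begin
    ∑ˢ n (λ A → ψ₀ k ∣ A ∣)
      ≡⟨ ∑ᴸ-cong (allSubsets n) (sym ∘ in-fibre-of-closure) ⟩
    ∑ˢ n (λ A → ∑ˢ n (λ K → inFibre K A * term K A))
      ≡⟨ ∑ᴸ-swap (allSubsets n) (allSubsets n) (λ A K → inFibre K A * term K A) ⟩
    ∑ˢ n (λ K → ∑ˢ n (λ A → inFibre K A * term K A))
      ≡⟨ ∑ᴸ-cong (allSubsets n) (λ K → trans
           (∑ᴸ-cong (allSubsets n) (λ A → *-Comm.x∙yz≈y∙xz (inFibre K A) (𝟙 (convex F K)) (ψ₀ k ∣ A ∣)))
           (∑ᴸ-*ˡ (allSubsets n) (𝟙 (convex F K)) (λ A → inFibre K A * ψ₀ k ∣ A ∣))) ⟩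
    ∑ˢ n (λ K → 𝟙 (convex F K) * ∑ˢ n (λ A → inFibre K A * ψ₀ k ∣ A ∣))
      ≡⟨ ∑ᴸ-cong (allSubsets n) (convex-∑-fibre k) ⟩
    ∑ˢ n (λ K → 𝟙 (convex F K) * ψ k ∣ K ∣ (interiorSize K)) ∎
    where
    open ≡-Reasoning
    term : Subset n → Subset n → ℤ
    term K A = 𝟙 (convex F K) * ψ₀ k ∣ A ∣
    in-fibre-of-closure : ∀ A → ∑ˢ n (λ K → inFibre K A * term K A) ≡ ψ₀ k ∣ A ∣
    in-fibre-of-closure A = trans (∑ˢ-point n (closure F A) (λ K → term K A))
      (trans (cong (λ b → 𝟙 b * ψ₀ k ∣ A ∣) (closure-convex A)) (ℤ.*-identityˡ (ψ₀ k ∣ A ∣)))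

  E≡intervalSum : ∀ k → E F k ≡ intervalSum (ψ₀ k) 0 n
  E≡intervalSum k = begin
    E F k
      ≡⟨ E≡∑weight k ⟩
    ∑ˢ n (λ K → 𝟙 (convex F K) * weight k ∣ K ∣ (interiorSize K))
      ≡⟨ ∑ᴸ-cong (allSubsets n) (λ K → cong (_*_ (𝟙 (convex F K))) (weight≡ψ k ∣ K ∣ (interiorSize K))) ⟩
    ∑ˢ n (λ K → 𝟙 (convex F K) * ψ k ∣ K ∣ (interiorSize K))
      ≡⟨ ∑ψ₀≡∑ψ k ⟨
    ∑ˢ n (λ A → ψ₀ k ∣ A ∣)
      ≡⟨ ∑ˢ-size n (ψ₀ k) ⟩
    intervalSum (ψ₀ k) 0 n ∎
    where open ≡-Reasoning

corollary4p4 : (n : ℕ) (F : Family n) → IsAntimatroid F →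
                 ((k : ℕ) → k < n → E F k ≡ + 0) × (E F n ≡ + 1)
corollary4p4 n F isAntimatroid =
  (λ k k<n → trans (E≡intervalSum isAntimatroid k) (intervalSum-ψ₀-> n k<n)) ,
  trans (E≡intervalSum isAntimatroid n) (intervalSum-ψ₀-≤ n ℕ.≤-refl)
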